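{- Let $n_1,n_2\ge 2$ be integers and $d:=\gcd(n_1,n_2)$. Suppose that for all positive integers $d_1,d_2$ with $d_1+d_2=d$ we have $\gcd(n_1,d_1)\ge2$ or $\gcd(n_2,d_2)\ge 2$. Then the perimeter gap of $\vec{C}_{n_1}\,\square\,\vec{C}_{n_2}$ is at least $d$.
   Context: $\vec{C}_m$ denotes the directed cycle on $m$ vertices. For digraphs $D_1,D_2$, the Cartesian product $D_1\,\square\,D_2$ has vertex set $V(D_1)\times V(D_2)$ with an arc from $(u_1,u_2)$ to $(v_1,v_2)$ iff either $u_1=v_1$ and $(u_2,v_2)$ is an arc of $D_2$, or $u_2=v_2$ and $(u_1,v_1)$ is an arc of $D_1$. The perimeter gap of a digraph is its number of vertices minus the length of its longest directed cycle. -}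

module Defs where

open import Data.Nat using (ℕ; zero; suc; _+_; _*_; _≤_)
open import Data.Fin using (Fin; toℕ)
open import Data.Product using (_×_; _,_)
open import Data.Sum using (_⊎_)
open import Relation.Binary.PropositionalEquality using (_≡_)
open import Function.Definitions using (Injective)

Digraph : Set → Set₁
Digraph V = V → V → Set

C⃗ : (m : ℕ) → Digraph (Fin m)
C⃗ m i j = (suc (toℕ i) ≡ toℕ j) ⊎ ((suc (toℕ i) ≡ m) × (toℕ j ≡ 0))

_□_ : {V W : Set} → Digraph V → Digraph W → Digraph (V × W)
(D₁ □ D₂) (u₁ , u₂) (v₁ , v₂) = ((u₁ ≡ v₁) × D₂ u₂ v₂) ⊎ ((u₂ ≡ v₂) × D₁ u₁ v₁)

record DirectedCycle {V : Set} (D : Digraph V) (L : ℕ) : Set where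
  field
    pos    : 1 ≤ L
    vertex : Fin L → V
    inj    : Injective _≡_ _≡_ vertex
    arcs   : ∀ i j → C⃗ L i j → D (vertex i) (vertex j)

-- "The perimeter gap of D (on N vertices) is at least g":
-- N minus the length of a longest directed cycle is ≥ g, i.e. every
-- directed cycle has length L with L + g ≤ N.
PerimeterGap≥ : {V : Set} → Digraph V → (N g : ℕ) → Set
PerimeterGap≥ D N g = ∀ L → DirectedCycle D L → L + g ≤ N

-- Follow a directed cycle of length L in the torus ℤ/n₁ × ℤ/n₂ from one of its vertices:
-- every step adds (1,0) or (0,1), and after L steps the walk is back, so the numbers of
-- east and north steps are multiples of n₁ and n₂ and d = gcd n₁ n₂ divides L.  As d also
-- divides n₁ n₂, it remains to exclude a Hamiltonian cycle.  There, if u steps east then so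
-- does u + (1,−1): otherwise both would step to u + (1,0).  By Bézout every translation
-- (x,k) with x + k = d is a multiple of (1,−1), so an east step is followed by an east step
-- d places later; since d ∣ L, going once around the cycle makes the step directions
-- d-periodic.  With d₁ east and d₂ north steps among the first d, the vertex reached after
-- q d steps is the start plus (q d₁, q d₂).  The cycle reaches the start plus (1,−1) after
-- m ≡ 1 − 1 ≡ 0 (mod d) steps, which forces gcd n₁ d₁ = gcd n₂ d₂ = 1, contradicting the
-- hypothesis.

module Submission where

open import Defs
open import Data.Bool.Base using (Bool; true; false; not; if_then_else_)
open import Data.Bool.Properties using (⇔→≡)
open import Data.Empty using (⊥-elim)
open import Data.Fin.Base using (Fin; toℕ; punchOut; combine)
open import Data.Fin.Properties
  using (toℕ-injective; toℕ-fromℕ<; toℕ<n; punchOut-injective; injective⇒≤; combine-injective; any?)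
  renaming (_≟_ to _≟ᶠ_)
open import Data.Nat.Base
open import Data.Nat.Coprimality using (Coprime; coprime⇒gcd≡1; ¬0-coprimeTo-2+) renaming (sym to coprime-sym)
open import Data.Nat.DivMod
open import Data.Nat.Divisibility
open import Data.Nat.GCD using (gcd; gcd-GCD; gcd[m,n]∣m; gcd[m,n]∣n; module Bézout)
open import Data.Nat.Properties
open import Data.Nat.Tactic.RingSolver using (solve-∀)
open import Data.Product.Base using (∃; ∃₂; _×_; _,_; proj₁; proj₂; uncurry)
open import Data.Product.Properties using (≡-dec)
open import Data.Sum.Base using (inj₁; inj₂; _⊎_)
open import Function.Base using (_∘_)
open import Function.Bundles using (mk⇔)
open import Function.Definitions using (Injective)
open import Relation.Binary.PropositionalEquality
open import Relation.Nullary using (¬_; Dec; yes; no; does; contradiction)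

%-congˡ-+ : ∀ {i j} k {n} .{{_ : NonZero n}} → i % n ≡ j % n → (i + k) % n ≡ (j + k) % n
%-congˡ-+ {i} {j} k {n} eq = begin
  (i + k) % n          ≡⟨ %-distribˡ-+ i k n ⟩
  (i % n + k % n) % n  ≡⟨ cong (λ r → (r + k % n) % n) eq ⟩
  (j % n + k % n) % n  ≡⟨ %-distribˡ-+ j k n ⟨
  (j + k) % n          ∎
  where open ≡-Reasoning

%-congʳ-+ : ∀ k {i j n} .{{_ : NonZero n}} → i % n ≡ j % n → (k + i) % n ≡ (k + j) % n
%-congʳ-+ k {i} {j} {n} eq = begin
  (k + i) % n  ≡⟨ cong (_% n) (+-comm k i) ⟩
  (i + k) % n  ≡⟨ %-congˡ-+ k eq ⟩
  (j + k) % n  ≡⟨ cong (_% n) (+-comm j k) ⟩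
  (k + j) % n  ∎
  where open ≡-Reasoning

%-cancelʳ-+ : ∀ k {i j n} .{{_ : NonZero n}} → (i + k) % n ≡ (j + k) % n → i % n ≡ j % n
%-cancelʳ-+ k {i} {j} {n} eq = begin
  i % n                     ≡⟨ [m+kn]%n≡m%n i k n ⟨
  (i + k * n) % n           ≡⟨ cong (_% n) (split i) ⟩
  (i + k + k * pred n) % n  ≡⟨ %-congˡ-+ (k * pred n) eq ⟩
  (j + k + k * pred n) % n  ≡⟨ cong (_% n) (split j) ⟨
  (j + k * n) % n           ≡⟨ [m+kn]%n≡m%n j k n ⟩
  j % n                     ∎
  where
  open ≡-Reasoning
  split : ∀ m → m + k * n ≡ m + k + k * pred n
  split m = begin
    m + k * n                ≡⟨ cong (λ n′ → m + k * n′) (suc-pred n) ⟨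
    m + k * suc (pred n)     ≡⟨ cong (m +_) (*-suc k (pred n)) ⟩
    m + (k + k * pred n)     ≡⟨ +-assoc m k (k * pred n) ⟨
    m + k + k * pred n       ∎

%-cancelˡ-+ : ∀ k {i j n} .{{_ : NonZero n}} → (k + i) % n ≡ (k + j) % n → i % n ≡ j % n
%-cancelˡ-+ k {i} {j} {n} eq = %-cancelʳ-+ k (begin
  (i + k) % n  ≡⟨ cong (_% n) (+-comm i k) ⟩
  (k + i) % n  ≡⟨ eq ⟩
  (k + j) % n  ≡⟨ cong (_% n) (+-comm k j) ⟩
  (j + k) % n  ∎)
  where open ≡-Reasoning

m%n≡r%n⇒m≡r+[m/n]*n : ∀ {m r n} .{{_ : NonZero n}} → r < n → m % n ≡ r % n → m ≡ r + m / n * n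
m%n≡r%n⇒m≡r+[m/n]*n {m} {r} {n} r<n eq = begin
  m                  ≡⟨ m≡m%n+[m/n]*n m n ⟩
  m % n + m / n * n  ≡⟨ cong (_+ m / n * n) (trans eq (m<n⇒m%n≡m r<n)) ⟩
  r + m / n * n      ∎
  where open ≡-Reasoning

0%n≡0 : ∀ n .{{_ : NonZero n}} → 0 % n ≡ 0
0%n≡0 n = m*n%n≡0 0 n

m%n≡0%n⇒n∣m : ∀ {m n} .{{_ : NonZero n}} → m % n ≡ 0 % n → n ∣ m
m%n≡0%n⇒n∣m {m} {n} eq = m%n≡0⇒n∣m m n (trans eq (0%n≡0 n))

m<n⇒m+d≤n : ∀ {d m n} → d ∣ m → d ∣ n → m < n → m + d ≤ n
m<n⇒m+d≤n {d} (divides-refl a) (divides-refl b) ad<bd = begin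
  a * d + d  ≡⟨ +-comm (a * d) d ⟩
  suc a * d  ≤⟨ *-monoˡ-≤ d (*-cancelʳ-< d a b ad<bd) ⟩
  b * d      ∎
  where open ≤-Reasoning

bézout-difference : ∀ m n .{{_ : NonZero n}} → ∃₂ λ u w → gcd m n + u * m ≡ w * n
bézout-difference m n with Bézout.identity (gcd-GCD m n)
... | Bézout.Identity.-+ x y eq = x , y , eq
-- Here d + y n = x m; multiplying by n − 1 ≡ −1 (mod n) flips the signs.
... | Bézout.Identity.+- x y eq = x * pred n , gcd m n + y * pred n , (begin
  d + x * pred n * m            ≡⟨ cong (d +_) (rotate x (pred n) m) ⟩
  d + x * m * pred n            ≡⟨ cong (λ t → d + t * pred n) eq ⟨
  d + (d + y * n) * pred n      ≡⟨ cong (λ n′ → d + (d + y * n′) * pred n) (suc-pred n) ⟨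
  d + (d + y * suc (pred n)) * pred n  ≡⟨ expand d y (pred n) ⟩
  (d + y * pred n) * suc (pred n)      ≡⟨ cong (λ n′ → (d + y * pred n) * n′) (suc-pred n) ⟩
  (d + y * pred n) * n          ∎)
  where
  open ≡-Reasoning
  d : ℕ
  d = gcd m n
  rotate : ∀ a b c → a * b * c ≡ a * c * b
  rotate = solve-∀
  expand : ∀ a b c → a + (a + b * suc c) * c ≡ (a + b * c) * suc c
  expand = solve-∀

module _ {n : ℕ} .{{_ : NonZero n}} where

  infixr 6 _⊕_
  _⊕_ : ℕ → Fin n → Fin n
  j ⊕ a = (j + toℕ a) mod n

  toℕ-mod : ∀ m → toℕ (m mod n) ≡ m % n
  toℕ-mod m = toℕ-fromℕ< (m%n<n m n)

  mod-cong : ∀ {i j} → i % n ≡ j % n → i mod n ≡ j mod n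
  mod-cong {i} {j} eq = toℕ-injective (trans (toℕ-mod i) (trans eq (sym (toℕ-mod j))))

  mod-injective : ∀ {i j} → i mod n ≡ j mod n → i % n ≡ j % n
  mod-injective {i} {j} eq = trans (sym (toℕ-mod i)) (trans (cong toℕ eq) (toℕ-mod j))

  toℕ-mod-toℕ : ∀ (a : Fin n) → toℕ a mod n ≡ a
  toℕ-mod-toℕ a = toℕ-injective (trans (toℕ-mod (toℕ a)) (m<n⇒m%n≡m (toℕ<n a)))

  ⊕-identityˡ : ∀ a → 0 ⊕ a ≡ a
  ⊕-identityˡ = toℕ-mod-toℕ

  ⊕-assoc : ∀ j k a → j ⊕ k ⊕ a ≡ (j + k) ⊕ a
  ⊕-assoc j k a = mod-cong (begin
    (j + toℕ (k ⊕ a)) % n     ≡⟨ cong (λ r → (j + r) % n) (toℕ-mod (k + toℕ a)) ⟩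
    (j + (k + toℕ a) % n) % n ≡⟨ %-congʳ-+ j (m%n%n≡m%n (k + toℕ a) n) ⟩
    (j + (k + toℕ a)) % n     ≡⟨ cong (_% n) (+-assoc j k (toℕ a)) ⟨
    (j + k + toℕ a) % n       ∎)
    where open ≡-Reasoning

  ⊕-congˡ : ∀ {j k} a → j % n ≡ k % n → j ⊕ a ≡ k ⊕ a
  ⊕-congˡ a eq = mod-cong (%-congˡ-+ (toℕ a) eq)

  ⊕-cancelʳ : ∀ {j k} a → j ⊕ a ≡ k ⊕ a → j % n ≡ k % n
  ⊕-cancelʳ a eq = %-cancelʳ-+ (toℕ a) (mod-injective eq)

  suc-mod : ∀ i → suc i mod n ≡ 1 ⊕ (i mod n)
  suc-mod i = mod-cong (begin
    suc i % n                  ≡⟨ %-congʳ-+ 1 (m%n%n≡m%n i n) ⟨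
    (1 + i % n) % n            ≡⟨ cong (λ r → (1 + r) % n) (toℕ-mod i) ⟨
    (1 + toℕ (i mod n)) % n    ∎)
    where open ≡-Reasoning

  C⃗-⊕1 : ∀ a → C⃗ n a (1 ⊕ a)
  C⃗-⊕1 a with suc (toℕ a) <? n
  ... | yes 1+a<n = inj₁ (sym (trans (toℕ-mod (suc (toℕ a))) (m<n⇒m%n≡m 1+a<n)))
  ... | no 1+a≮n = inj₂ (1+a≡n , trans (toℕ-mod (suc (toℕ a))) (trans (cong (_% n) 1+a≡n) (n%n≡0 n)))
    where
    1+a≡n : suc (toℕ a) ≡ n
    1+a≡n = ≤-antisym (toℕ<n a) (≮⇒≥ 1+a≮n)

  C⃗-target : ∀ {a b} → C⃗ n a b → b ≡ 1 ⊕ a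
  C⃗-target {a} {b} (inj₁ 1+a≡b) = toℕ-injective (begin
    toℕ b              ≡⟨ 1+a≡b ⟨
    suc (toℕ a)        ≡⟨ m<n⇒m%n≡m (subst (_< n) (sym 1+a≡b) (toℕ<n b)) ⟨
    suc (toℕ a) % n    ≡⟨ toℕ-mod (suc (toℕ a)) ⟨
    toℕ (1 ⊕ a)        ∎)
    where open ≡-Reasoning
  C⃗-target {a} {b} (inj₂ (1+a≡n , b≡0)) = toℕ-injective (begin
    toℕ b              ≡⟨ b≡0 ⟩
    0                  ≡⟨ n%n≡0 n ⟨
    n % n              ≡⟨ cong (_% n) 1+a≡n ⟨
    suc (toℕ a) % n    ≡⟨ toℕ-mod (suc (toℕ a)) ⟨
    toℕ (1 ⊕ a)        ∎)
    where open ≡-Reasoning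

injective⇒surjective : ∀ {n} (f : Fin n → Fin n) → Injective _≡_ _≡_ f → ∀ y → ∃ λ x → f x ≡ y
injective⇒surjective {suc n} f f-injective y with any? (λ x → f x ≟ᶠ y)
... | yes hit = hit
... | no miss = contradiction (injective⇒≤ g-injective) 1+n≰n
  where
  y≢f : ∀ x → y ≢ f x
  y≢f x y≡fx = miss (x , sym y≡fx)
  g : Fin (suc n) → Fin n
  g x = punchOut (y≢f x)
  g-injective : Injective _≡_ _≡_ g
  g-injective {x} {x′} eq = f-injective (punchOut-injective (y≢f x) (y≢f x′) eq)

module _ {m n : ℕ} {D : Digraph (Fin m × Fin n)} {L : ℕ} (cycle : DirectedCycle D L) where
  open DirectedCycle cycle

  private
    encode : Fin m × Fin n → Fin (m * n)
    encode = uncurry combine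

    encode-injective : Injective _≡_ _≡_ encode
    encode-injective {a , b} {a′ , b′} eq with combine-injective a b a′ b′ eq
    ... | refl , refl = refl

    encode∘vertex-injective : Injective _≡_ _≡_ (encode ∘ vertex)
    encode∘vertex-injective = inj ∘ encode-injective

  cycle-length≤ : L ≤ m * n
  cycle-length≤ = injective⇒≤ encode∘vertex-injective

  hamiltonian-cycle-surjective : L ≡ m * n → ∀ v → ∃ λ i → vertex i ≡ v
  hamiltonian-cycle-surjective refl v with injective⇒surjective _ encode∘vertex-injective (encode v)
  ... | i , eq = i , encode-injective eq

bit : Bool → ℕ
bit b = if b then 1 else 0

count : (ℕ → Bool) → ℕ → ℕ
count p zero    = 0
count p (suc n) = bit (p n) + count p n

count+count-not : ∀ p n → count p n + count (not ∘ p) n ≡ n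
count+count-not p zero = refl
count+count-not p (suc n) with p n
... | true  = cong suc (count+count-not p n)
... | false = trans (+-suc (count p n) _) (cong suc (count+count-not p n))

module _ {p : ℕ → Bool} {d : ℕ} (periodic : ∀ i → p (d + i) ≡ p i) where

  count-+-period : ∀ i → count p (i + d) ≡ count p i + count p d
  count-+-period zero    = refl
  count-+-period (suc i) = begin
    bit (p (i + d)) + count p (i + d)           ≡⟨ cong₂ _+_ (cong bit p[i+d]≡p[i]) (count-+-period i) ⟩
    bit (p i) + (count p i + count p d)         ≡⟨ +-assoc (bit (p i)) (count p i) (count p d) ⟨
    bit (p i) + count p i + count p d           ∎
    where
    open ≡-Reasoning
    p[i+d]≡p[i] : p (i + d) ≡ p i
    p[i+d]≡p[i] = trans (cong p (+-comm i d)) (periodic i)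

  count-*-period : ∀ q → count p (q * d) ≡ q * count p d
  count-*-period zero    = refl
  count-*-period (suc q) = begin
    count p (d + q * d)        ≡⟨ cong (count p) (+-comm d (q * d)) ⟩
    count p (q * d + d)        ≡⟨ count-+-period (q * d) ⟩
    count p (q * d) + count p d ≡⟨ cong (_+ count p d) (count-*-period q) ⟩
    q * count p d + count p d  ≡⟨ +-comm (q * count p d) (count p d) ⟩
    count p d + q * count p d  ∎
    where open ≡-Reasoning

true-closed⇒periodic : ∀ (p : ℕ → Bool) {d P} .{{_ : NonZero P}} → d ∣ P → (∀ i → p (P + i) ≡ p i) →
                       (∀ i → p i ≡ true → p (d + i) ≡ true) → ∀ i → p (d + i) ≡ p i
true-closed⇒periodic p {d} {P} (divides zero P≡0) _ _ _ = contradiction P≡0 (≢-nonZero⁻¹ P)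
true-closed⇒periodic p {d} {P} (divides (suc r) P≡d+rd) P-periodic closed i =
  ⇔→≡ (mk⇔ backward (closed i))
  where
  iterate : ∀ s j → p j ≡ true → p (s * d + j) ≡ true
  iterate zero    j pj = pj
  iterate (suc s) j pj = subst (λ k → p k ≡ true) (sym (+-assoc d (s * d) j)) (closed _ (iterate s j pj))
  backward : p (d + i) ≡ true → p i ≡ true
  backward pdi = begin
    p i                  ≡⟨ P-periodic i ⟨
    p (P + i)            ≡⟨ cong (λ k → p (k + i)) P≡d+rd ⟩
    p (d + r * d + i)    ≡⟨ cong p (trans (cong (_+ i) (+-comm d (r * d))) (+-assoc (r * d) d i)) ⟩
    p (r * d + (d + i))  ≡⟨ iterate r (d + i) pdi ⟩
    true                 ∎
    where open ≡-Reasoning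

module Torus (n₁ n₂ : ℕ) .{{_ : NonZero n₁}} .{{_ : NonZero n₂}} where

  Vertex : Set
  Vertex = Fin n₁ × Fin n₂

  _≟ᵛ_ : (u v : Vertex) → Dec (u ≡ v)
  _≟ᵛ_ = ≡-dec _≟ᶠ_ _≟ᶠ_

  translate : ℕ → ℕ → Vertex → Vertex
  translate j k (a , b) = j ⊕ a , k ⊕ b

  translate-identity : ∀ v → translate 0 0 v ≡ v
  translate-identity (a , b) = cong₂ _,_ (⊕-identityˡ a) (⊕-identityˡ b)

  translate-assoc : ∀ j k j′ k′ v → translate j k (translate j′ k′ v) ≡ translate (j + j′) (k + k′) v
  translate-assoc j k j′ k′ (a , b) = cong₂ _,_ (⊕-assoc j j′ a) (⊕-assoc k k′ b)

  translate-cong : ∀ {j k j′ k′} v → j % n₁ ≡ j′ % n₁ → k % n₂ ≡ k′ % n₂ →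
                   translate j k v ≡ translate j′ k′ v
  translate-cong (a , b) eq₁ eq₂ = cong₂ _,_ (⊕-congˡ a eq₁) (⊕-congˡ b eq₂)

  translate-cancel : ∀ {j k j′ k′} v → translate j k v ≡ translate j′ k′ v →
                     j % n₁ ≡ j′ % n₁ × k % n₂ ≡ k′ % n₂
  translate-cancel (a , b) eq = ⊕-cancelʳ a (cong proj₁ eq) , ⊕-cancelʳ b (cong proj₂ eq)

  □-arc : ∀ {u v} → (C⃗ n₁ □ C⃗ n₂) u v → v ≡ translate 1 0 u ⊎ v ≡ translate 0 1 u
  □-arc {a , b} (inj₁ (refl , arc)) = inj₂ (cong₂ _,_ (sym (⊕-identityˡ a)) (C⃗-target arc))
  □-arc {a , b} (inj₂ (refl , arc)) = inj₁ (cong₂ _,_ (C⃗-target arc) (sym (⊕-identityˡ b)))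

  T : Vertex → Vertex
  T = translate 1 (pred n₂)

  diagonal : ℕ → Vertex → Vertex
  diagonal s = translate s (s * pred n₂)

  diagonal-suc : ∀ s v → diagonal (suc s) v ≡ T (diagonal s v)
  diagonal-suc s v = sym (translate-assoc 1 (pred n₂) s (s * pred n₂) v)

  north∘T≡east : ∀ v → translate 0 1 (T v) ≡ translate 1 0 v
  north∘T≡east v = trans (translate-assoc 0 1 1 (pred n₂) v) (translate-cong v refl n₂≡0)
    where
    n₂≡0 : suc (pred n₂) % n₂ ≡ 0 % n₂
    n₂≡0 = trans (cong (_% n₂) (suc-pred n₂)) (trans (n%n≡0 n₂) (sym (0%n≡0 n₂)))

  translate-gcd≡diagonal : ∀ {x k} → x + k ≡ gcd n₁ n₂ → ∃ λ s → ∀ v → translate x k v ≡ diagonal s v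
  translate-gcd≡diagonal {x} {k} x+k≡d with bézout-difference n₁ n₂
  ... | u , w , d+un₁≡wn₂ = s , λ v → translate-cong v (sym ([m+kn]%n≡m%n x u n₁)) (sym sp≡k)
    where
    open ≡-Reasoning
    p s : ℕ
    p = pred n₂
    s = x + u * n₁
    rearrange : ∀ x k u n p → (x + u * n) * p + (x + k + u * n) ≡ k + (x + u * n) * suc p
    rearrange = solve-∀
    sp≡k : (s * p) % n₂ ≡ k % n₂
    sp≡k = begin
      (s * p) % n₂                          ≡⟨ [m+kn]%n≡m%n (s * p) w n₂ ⟨
      (s * p + w * n₂) % n₂                 ≡⟨ cong (λ t → (s * p + t) % n₂) d+un₁≡wn₂ ⟨
      (s * p + (gcd n₁ n₂ + u * n₁)) % n₂   ≡⟨ cong (λ t → (s * p + (t + u * n₁)) % n₂) x+k≡d ⟨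
      (s * p + (x + k + u * n₁)) % n₂       ≡⟨ cong (_% n₂) (rearrange x k u n₁ p) ⟩
      (k + s * suc p) % n₂                  ≡⟨ cong (λ n′ → (k + s * n′) % n₂) (suc-pred n₂) ⟩
      (k + s * n₂) % n₂                     ≡⟨ [m+kn]%n≡m%n k s n₂ ⟩
      k % n₂                                ∎

  eastward : (ℕ → Vertex) → ℕ → Bool
  eastward w i = does (w (suc i) ≟ᵛ translate 1 0 (w i))

  module _ (w : ℕ → Vertex) (arc : ∀ i → (C⃗ n₁ □ C⃗ n₂) (w i) (w (suc i))) where

    eastward-step : ∀ i → w (suc i) ≡ translate (bit (eastward w i)) (bit (not (eastward w i))) (w i)
    eastward-step i with w (suc i) ≟ᵛ translate 1 0 (w i) | □-arc (arc i)
    ... | yes east | _         = east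
    ... | no ¬east | inj₁ east = contradiction east ¬east
    ... | no _     | inj₂ north = north

    walk-displacement : ∀ t → w t ≡ translate (count (eastward w) t) (count (not ∘ eastward w) t) (w 0)
    walk-displacement zero    = sym (translate-identity (w 0))
    walk-displacement (suc t) = begin
      w (suc t)                                  ≡⟨ eastward-step t ⟩
      translate (bit e) (bit (not e)) (w t)      ≡⟨ cong (translate _ _) (walk-displacement t) ⟩
      translate (bit e) (bit (not e)) (translate (count (eastward w) t) (count (not ∘ eastward w) t) (w 0))
        ≡⟨ translate-assoc _ _ _ _ (w 0) ⟩
      translate (count (eastward w) (suc t)) (count (not ∘ eastward w) (suc t)) (w 0) ∎
      where
      open ≡-Reasoning
      e : Bool
      e = eastward w t

  module OnCycle {L : ℕ} (cycle : DirectedCycle (C⃗ n₁ □ C⃗ n₂) L) where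
    open DirectedCycle cycle

    instance
      L-nonZero : NonZero L
      L-nonZero = >-nonZero pos

    walk : ℕ → Vertex
    walk i = vertex (i mod L)

    walk-arc : ∀ i → (C⃗ n₁ □ C⃗ n₂) (walk i) (walk (suc i))
    walk-arc i = arcs _ _ (subst (C⃗ L (i mod L)) (sym (suc-mod i)) (C⃗-⊕1 (i mod L)))

    walk-cong : ∀ {i j} → i % L ≡ j % L → walk i ≡ walk j
    walk-cong = cong vertex ∘ mod-cong

    walk-injective : ∀ {i j} → walk i ≡ walk j → i % L ≡ j % L
    walk-injective = mod-injective ∘ inj

    walk-suc-cong : ∀ {i j} → walk i ≡ walk j → walk (suc i) ≡ walk (suc j)
    walk-suc-cong = walk-cong ∘ %-congʳ-+ 1 {n = L} ∘ walk-injective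

    walk-suc-injective : ∀ {i j} → walk (suc i) ≡ walk (suc j) → walk i ≡ walk j
    walk-suc-injective = walk-cong ∘ %-cancelˡ-+ 1 {n = L} ∘ walk-injective

    east : ℕ → Bool
    east = eastward walk

    #east #north : ℕ → ℕ
    #east  = count east
    #north = count (not ∘ east)

    east-cong : ∀ {i j} → walk i ≡ walk j → east i ≡ east j
    east-cong eq = cong₂ (λ u v → does (v ≟ᵛ translate 1 0 u)) eq (walk-suc-cong eq)

    walk-step : ∀ {i b} → east i ≡ b → walk (suc i) ≡ translate (bit b) (bit (not b)) (walk i)
    walk-step refl = eastward-step walk walk-arc _

    walk-position : ∀ t → walk t ≡ translate (#east t) (#north t) (walk 0)
    walk-position = walk-displacement walk walk-arc

    walk-shift : ∀ t i → ∃₂ λ x k → x + k ≡ t × walk (t + i) ≡ translate x k (walk i)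
    walk-shift t i = _ , _ , count+count-not _ t , walk-displacement (walk ∘ (_+ i)) (walk-arc ∘ (_+ i)) t

    gcd∣cycle-length : gcd n₁ n₂ ∣ L
    gcd∣cycle-length = subst (gcd n₁ n₂ ∣_) (count+count-not east L)
      (∣m∣n⇒∣m+n (∣-trans (gcd[m,n]∣m n₁ n₂) (m%n≡0%n⇒n∣m (proj₁ closed)))
                  (∣-trans (gcd[m,n]∣n n₁ n₂) (m%n≡0%n⇒n∣m (proj₂ closed))))
      where
      closed : #east L % n₁ ≡ 0 % n₁ × #north L % n₂ ≡ 0 % n₂
      closed = translate-cancel (walk 0) (begin
        translate (#east L) (#north L) (walk 0)  ≡⟨ walk-position L ⟨
        walk L                                   ≡⟨ walk-cong (trans (n%n≡0 L) (sym (0%n≡0 L))) ⟩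
        walk 0                                   ≡⟨ translate-identity (walk 0) ⟨
        translate 0 0 (walk 0)                   ∎)
        where open ≡-Reasoning

  module Hamiltonian .{{_ : NonTrivial n₁}} (cycle : DirectedCycle (C⃗ n₁ □ C⃗ n₂) (n₁ * n₂)) where
    open DirectedCycle cycle using (vertex)
    open OnCycle cycle

    walk-surjective : ∀ v → ∃ λ i → walk i ≡ v
    walk-surjective v with hamiltonian-cycle-surjective cycle refl v
    ... | i , eq = toℕ i , trans (cong vertex (toℕ-mod-toℕ i)) eq

    T-not-fixed : ∀ v → T v ≢ v
    T-not-fixed v Tv≡v = nonTrivial⇒≢1 (∣1⇒≡1 (m%n≡0%n⇒n∣m (proj₁ (translate-cancel v Tv≡0v))))
      where
      Tv≡0v : T v ≡ translate 0 0 v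
      Tv≡0v = trans Tv≡v (sym (translate-identity v))

    T-preserves-east : ∀ {i j} → east i ≡ true → walk j ≡ T (walk i) → east j ≡ true
    T-preserves-east {i} {j} east-i walk-j with east j in east-j
    ... | true  = refl
    ... | false = contradiction (trans (sym walk-j) (walk-suc-injective successors-coincide)) (T-not-fixed (walk i))
      where
      open ≡-Reasoning
      successors-coincide : walk (suc j) ≡ walk (suc i)
      successors-coincide = begin
        walk (suc j)                ≡⟨ walk-step east-j ⟩
        translate 0 1 (walk j)      ≡⟨ cong (translate 0 1) walk-j ⟩
        translate 0 1 (T (walk i))  ≡⟨ north∘T≡east (walk i) ⟩
        translate 1 0 (walk i)      ≡⟨ walk-step east-i ⟨
        walk (suc i)                ∎

    diagonal-preserves-east : ∀ s {i j} → east i ≡ true → walk j ≡ diagonal s (walk i) → east j ≡ true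
    diagonal-preserves-east zero    east-i walk-j = trans (east-cong (trans walk-j (translate-identity _))) east-i
    diagonal-preserves-east (suc s) {i} east-i walk-j with walk-surjective (diagonal s (walk i))
    ... | k , walk-k = T-preserves-east (diagonal-preserves-east s east-i walk-k)
                                        (trans walk-j (trans (diagonal-suc s (walk i)) (cong T (sym walk-k))))

    east-forward : ∀ i → east i ≡ true → east (gcd n₁ n₂ + i) ≡ true
    east-forward i east-i with walk-shift (gcd n₁ n₂) i
    ... | x , k , x+k≡d , shift with translate-gcd≡diagonal x+k≡d
    ... | s , diagonal-s = diagonal-preserves-east s east-i (trans shift (diagonal-s (walk i)))

    east-periodic : ∀ i → east (gcd n₁ n₂ + i) ≡ east i
    east-periodic = true-closed⇒periodic east gcd∣cycle-length
      (λ i → east-cong (walk-cong (%-remove-+ˡ i {n₁ * n₂} ∣-refl))) east-forward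

    T-reached : ∃₂ λ m α → #east m ≡ 1 + α * n₁ × n₂ ∣ 1 + #north m
    T-reached with walk-surjective (T (walk 0))
    ... | m , walk-m with translate-cancel (walk 0) (begin
      translate (#east m) (1 + #north m) (walk 0)             ≡⟨ translate-assoc 0 1 _ _ (walk 0) ⟨
      translate 0 1 (translate (#east m) (#north m) (walk 0)) ≡⟨ cong (translate 0 1) (walk-position m) ⟨
      translate 0 1 (walk m)                                  ≡⟨ cong (translate 0 1) walk-m ⟩
      translate 0 1 (T (walk 0))                              ≡⟨ north∘T≡east (walk 0) ⟩
      translate 1 0 (walk 0)                                  ∎)
      where open ≡-Reasoning
    ... | east≡1 , north≡-1 =
      m , #east m / n₁ , m%n≡r%n⇒m≡r+[m/n]*n (nonTrivial⇒n>1 n₁) east≡1 , m%n≡0%n⇒n∣m north≡-1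

    gcd∣T-index : ∀ m α → #east m ≡ 1 + α * n₁ → n₂ ∣ 1 + #north m → gcd n₁ n₂ ∣ m
    gcd∣T-index m α #east-m n₂∣1+#north-m = subst (gcd n₁ n₂ ∣_) (begin
      α * n₁ + (1 + #north m)  ≡⟨ +-suc (α * n₁) (#north m) ⟩
      1 + α * n₁ + #north m    ≡⟨ cong (_+ #north m) #east-m ⟨
      #east m + #north m       ≡⟨ count+count-not east m ⟩
      m                        ∎)
      (∣m∣n⇒∣m+n (∣n⇒∣m*n α (gcd[m,n]∣m n₁ n₂)) (∣-trans (gcd[m,n]∣n n₁ n₂) n₂∣1+#north-m))
      where open ≡-Reasoning

    #east-multiple : ∀ q → #east (q * gcd n₁ n₂) ≡ q * #east (gcd n₁ n₂)
    #east-multiple = count-*-period east-periodic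

    #north-multiple : ∀ q → #north (q * gcd n₁ n₂) ≡ q * #north (gcd n₁ n₂)
    #north-multiple = count-*-period (cong not ∘ east-periodic)

    hamiltonian⇒coprime-split : ∃₂ λ d₁ d₂ → d₁ + d₂ ≡ gcd n₁ n₂ × Coprime n₁ d₁ × Coprime n₂ d₂
    hamiltonian⇒coprime-split with T-reached
    ... | m , α , #east-m , n₂∣1+#north-m with gcd∣T-index m α #east-m n₂∣1+#north-m
    ... | divides-refl q = #east d , #north d , count+count-not east d , coprime₁ , coprime₂
      where
      d : ℕ
      d = gcd n₁ n₂
      coprime₁ : Coprime n₁ (#east d)
      coprime₁ {e} (e∣n₁ , e∣d₁) = ∣1⇒≡1 (∣m+n∣m⇒∣n e∣αn₁+1 (∣n⇒∣m*n α e∣n₁))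
        where
        e∣αn₁+1 : e ∣ α * n₁ + 1
        e∣αn₁+1 = subst (e ∣_) (trans (sym (#east-multiple q)) (trans #east-m (+-comm 1 (α * n₁))))
                        (∣n⇒∣m*n q e∣d₁)
      coprime₂ : Coprime n₂ (#north d)
      coprime₂ {e} (e∣n₂ , e∣d₂) = ∣1⇒≡1 (∣m+n∣m⇒∣n e∣#north+1 e∣#north)
        where
        e∣#north : e ∣ #north (q * d)
        e∣#north = subst (e ∣_) (sym (#north-multiple q)) (∣n⇒∣m*n q e∣d₂)
        e∣#north+1 : e ∣ #north (q * d) + 1
        e∣#north+1 = subst (e ∣_) (+-comm 1 _) (∣-trans e∣n₂ n₂∣1+#north-m)

lemma3p2 : (n₁ n₂ : ℕ) → 2 ≤ n₁ → 2 ≤ n₂ →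
    (∀ d₁ d₂ → 1 ≤ d₁ → 1 ≤ d₂ → d₁ + d₂ ≡ gcd n₁ n₂ →
      2 ≤ gcd n₁ d₁ ⊎ 2 ≤ gcd n₂ d₂) →
    PerimeterGap≥ (C⃗ n₁ □ C⃗ n₂) (n₁ * n₂) (gcd n₁ n₂)
lemma3p2 n₁ n₂ (s≤s (s≤s _)) (s≤s (s≤s _)) split L cycle with L ≟ n₁ * n₂
... | yes refl = ⊥-elim (no-coprime-split (Torus.Hamiltonian.hamiltonian⇒coprime-split n₁ n₂ cycle))
  where
  no-coprime-split : ¬ ∃₂ λ d₁ d₂ → d₁ + d₂ ≡ gcd n₁ n₂ × Coprime n₁ d₁ × Coprime n₂ d₂
  no-coprime-split (zero  , _     , _   , coprime₁ , _) = ¬0-coprimeTo-2+ (coprime-sym coprime₁)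
  no-coprime-split (suc _ , zero  , _   , _ , coprime₂) = ¬0-coprimeTo-2+ (coprime-sym coprime₂)
  no-coprime-split (suc a , suc b , sum , coprime₁ , coprime₂) with split (suc a) (suc b) (s≤s z≤n) (s≤s z≤n) sum
  ... | inj₁ 2≤gcd = 1+n≰n (subst (2 ≤_) (coprime⇒gcd≡1 coprime₁) 2≤gcd)
  ... | inj₂ 2≤gcd = 1+n≰n (subst (2 ≤_) (coprime⇒gcd≡1 coprime₂) 2≤gcd)
... | no L≢n₁n₂ = m<n⇒m+d≤n (Torus.OnCycle.gcd∣cycle-length n₁ n₂ cycle)
                             (∣-trans (gcd[m,n]∣m n₁ n₂) (m∣m*n n₂))
                             (≤∧≢⇒< (cycle-length≤ cycle) L≢n₁n₂)
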